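{- Fix polytopes $P_1,\dots,P_r$ in $\mathcal{A}[n]$ and polytopes $V,U$, and let $W=V\odot U$. Assume $\mathcal{M}_U\neq\emptyset$. Then $\mathcal{M}_{W,V}\ne\emptyset$ and the canonical solution $\mathcal{C}_{W,V}$ equals $\mathcal{C}_U\odot V$, the coordinatewise Minkowski sum of the canonical solution $\mathcal{C}_U$ of $U=(Y_1\odot P_1)\oplus\cdots\oplus(Y_r\odot P_r)$ with $V$.
   Context: $\mathcal{A}[n]$: lattice polytopes with vertices in $\mathbb{Z}^n_{\ge0}$ plus $0_{\mathcal{A}}$; $\oplus$ = convex hull of union, $\odot$ = Minkowski sum, $0_{\mathcal{A}}$ additive identity and absorbing. For a polytope $X$, $\mathcal{M}_X$ is the (finite) set of tuples $(Y_1,\dots,Y_r)\in\mathcal{A}[n]^r$ with $X=\bigoplus_i(P_i\odot Y_i)$; if nonempty, its canonical solution $\mathcal{C}_X$ is the coordinatewise $\oplus$ of all elements of $\mathcal{M}_X$. For a polytope $V$, $\mathcal{M}_{X,V}\subseteq\mathcal{M}_X$ is the set of solutions in which $V$ is a Minkowski summand of every $Y_i$ (i.e. $Y_i=V\odot Y_i'$ with $Y_i'\in\mathcal{A}[n]$); if nonempty, $\mathcal{C}_{X,V}$ is the coordinatewise $\oplus$ of all its elements. -}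

module Defs where

open import Data.Nat using (ℕ) renaming (_+_ to _+ℕ_)
open import Data.Fin using (Fin; zero; suc)
open import Data.Maybe using (Maybe; just; nothing)
open import Data.List using (List; foldr; []; _∷_)
open import Data.List.NonEmpty as L⁺ using (List⁺; _⁺++⁺_; toList)
open import Data.List.Relation.Unary.All using (All)
open import Data.List.Relation.Unary.Any using (Any)
open import Data.Product using (Σ; ∃; _×_; _,_; proj₁; proj₂)
open import Data.Unit using (⊤)
open import Data.Empty using (⊥)
open import Data.Integer using (+_)
open import Data.Rational using (ℚ; 0ℚ; 1ℚ; _+_; _*_; _/_; _≤_)
open import Relation.Binary.PropositionalEquality using (_≡_)

Point : ℕ → Set
Point n = Fin n → ℕ

_+ᵥ_ : ∀ {n} → Point n → Point n → Point n
(a +ᵥ b) j = a j +ℕ b j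

-- A lattice polytope, given by a nonempty finite list of lattice points
-- (the polytope is their convex hull in ℝ^n).
Poly : ℕ → Set
Poly n = List⁺ (Point n)

𝒜 : ℕ → Set
𝒜 n = Maybe (Poly n)

0𝒜 : ∀ {n} → 𝒜 n
0𝒜 = nothing

_⊕_ : ∀ {n} → 𝒜 n → 𝒜 n → 𝒜 n
nothing ⊕ y = y
just p ⊕ nothing = just p
just p ⊕ just q = just (p ⁺++⁺ q)

_⊙_ : ∀ {n} → 𝒜 n → 𝒜 n → 𝒜 n
nothing ⊙ _ = nothing
just p ⊙ nothing = nothing
just p ⊙ just q = just (L⁺.concatMap (λ a → L⁺.map (λ b → a +ᵥ b) q) p)

ℕ→ℚ : ℕ → ℚ
ℕ→ℚ k = (+ k) / 1

sumℚ : List ℚ → ℚ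
sumℚ = foldr _+_ 0ℚ

InConv : ∀ {n} → Point n → Poly n → Set
InConv {n} x gs =
  Σ (List (ℚ × Point n)) λ cs →
    All (λ c → (0ℚ ≤ proj₁ c) × Any (λ g → g ≡ proj₂ c) (toList gs)) cs
    × sumℚ (Data.List.map proj₁ cs) ≡ 1ℚ
    × (∀ j → sumℚ (Data.List.map (λ c → proj₁ c * ℕ→ℚ (proj₂ c j)) cs) ≡ ℕ→ℚ (x j))
  where import Data.List

_⊑_ : ∀ {n} → 𝒜 n → 𝒜 n → Set
nothing ⊑ _ = ⊤
just p ⊑ nothing = ⊥
just p ⊑ just q = All (λ x → InConv x q) (toList p)

_≈_ : ∀ {n} → 𝒜 n → 𝒜 n → Set
X ≈ Y = (X ⊑ Y) × (Y ⊑ X)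

Tuple : ℕ → ℕ → Set
Tuple n r = Fin r → 𝒜 n

_≈ᵗ_ : ∀ {n r} → Tuple n r → Tuple n r → Set
Y ≈ᵗ Z = ∀ i → Y i ≈ Z i

⨁ : ∀ {n} r → (Fin r → 𝒜 n) → 𝒜 n
⨁ ℕ.zero f = 0𝒜
⨁ (ℕ.suc r) f = f zero ⊕ ⨁ r (λ i → f (suc i))

𝓜 : ∀ {n r} → Tuple n r → 𝒜 n → Tuple n r → Set
𝓜 {r = r} P X Y = X ≈ ⨁ r (λ i → P i ⊙ Y i)

Summand : ∀ {n} → 𝒜 n → 𝒜 n → Set
Summand V Y = ∃ λ Y' → Y ≈ (V ⊙ Y')

𝓜V : ∀ {n r} → Tuple n r → 𝒜 n → 𝒜 n → Tuple n r → Set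
𝓜V P X V Y = 𝓜 P X Y × (∀ i → Summand V (Y i))

Enumerates : ∀ {n r} → (Tuple n r → Set) → List (Tuple n r) → Set
Enumerates S L = All S L × (∀ Y → S Y → Any (λ Z → Y ≈ᵗ Z) L)

joinAll : ∀ {n r} → List (Tuple n r) → Tuple n r
joinAll L i = foldr (λ Y acc → Y i ⊕ acc) 0𝒜 L

IsCanonical : ∀ {n r} → (Tuple n r → Set) → Tuple n r → Set
IsCanonical S C = ∃ λ L → Enumerates S L × (C ≈ᵗ joinAll L)

-- Polytopes are handled through their lists of generating points: ⊙ becomes the list
-- of pairwise sums, ⊕ concatenation, and containment says that every generator is a
-- rational convex combination of the other list. In these terms ⊙ is commutative,
-- associative and distributes over ⊕, so Z ↦ Z ⊙ V sends solutions for U to solutions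
-- for V ⊙ U with summand V and commutes with the coordinatewise ⊕ defining canonical
-- solutions. Conversely, a solution Y with Y i ≈ V ⊙ Z i gives
-- V ⊙ U ≈ V ⊙ ⨁ (P i ⊙ Z i), and cancelling the nonempty V shows that Z solves U.
-- Hence shifting an enumeration of 𝓜_U by V enumerates 𝓜_{V⊙U,V}.
--
-- Cancellation (V ⊙ A ⊆ V ⊙ B ⇒ A ⊆ B) is proved by elimination. For a generator x of A
-- and every vertex y of V, x + y ∈ conv B + conv V, i.e. x + c·y = k + w with k ∈ conv B
-- and w a combination of weight c of the vertices. The row of one vertex either has no
-- weight left on the other vertices, and then x = k ∈ conv B, or it can be used to
-- eliminate that vertex from all other rows. An empty vertex list cannot carry the
-- positive weight that remains, so the elimination ends in the first case.

module Submission where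

open import Defs
open import Data.Nat as ℕ using (ℕ)
open import Data.Fin using (Fin; zero; suc)
open import Data.Maybe using (just; nothing)
open import Data.List as List using (List; []; _∷_; _++_; cartesianProductWith)
open import Data.List.Membership.Propositional using (_∈_)
open import Data.List.Membership.Propositional.Properties
  using (∈-cartesianProductWith⁺; ∈-cartesianProductWith⁻; ∈-++⁺ˡ; ∈-++⁺ʳ; ∈-++⁻)
open import Data.List.Relation.Unary.All as All using (All; []; _∷_)
import Data.List.Relation.Unary.All.Properties as AllP
import Data.List.Relation.Unary.Any.Properties as AnyP
open import Data.List.Relation.Unary.Any as Any using (here; there)
open import Data.List.NonEmpty as List⁺ using (toList)
open import Data.List.Relation.Binary.Subset.Propositional using (_⊆_)
open import Data.Sum using (_⊎_; inj₁; inj₂; [_,_]′)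
open import Data.Empty using (⊥-elim)
open import Relation.Binary.Definitions using (tri<; tri≈; tri>)
open import Data.Product using (∃; ∃₂; _×_; _,_; proj₁; proj₂; map₂)
open import Data.Vec.Functional using (Vector)
import Data.Integer as ℤ
import Data.Integer.Properties as ℤ
import Data.Nat.Properties as ℕ
open import Data.List.Properties using (cartesianProductWith-zeroʳ; ++-identityʳ)
open import Data.Rational as ℚ using (ℚ; 0ℚ; 1ℚ; _+_; _*_; _-_; _≤_; _<_; 1/_; toℚᵘ)
open import Data.Rational.Properties
open import Data.Rational.Unnormalised as ℚᵘ using (mkℚᵘ; *≡*)
import Data.Rational.Unnormalised.Properties as ℚᵘ
open import Data.Rational.Solver using (module +-*-Solver)
open +-*-Solver using (solve; con; _:+_; _:*_; _:-_; _:=_)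
open import Relation.Binary.PropositionalEquality
open import Relation.Binary.Bundles using (Setoid)
open import Relation.Binary.Structures using (IsEquivalence)
open import Level using (0ℓ)
open import Function using (id)
open import Algebra.Structures using (IsCommutativeSemigroup)
open import Algebra.Bundles using (CommutativeSemigroup)
import Algebra.Properties.CommutativeSemigroup as CommutativeSemigroupProperties
import Relation.Binary.Reasoning.Setoid as SetoidReasoning

private variable
  n : ℕ

ℕ→ℚ-+ : ∀ a b → ℕ→ℚ (a ℕ.+ b) ≡ ℕ→ℚ a + ℕ→ℚ b
ℕ→ℚ-+ a b = toℚᵘ-injective (begin
  toℚᵘ (ℕ→ℚ (a ℕ.+ b))            ≈⟨ toℚᵘ-fromℚᵘ (mkℚᵘ (ℤ.+ (a ℕ.+ b)) 0) ⟩
  mkℚᵘ (ℤ.+ (a ℕ.+ b)) 0            ≈⟨ *≡* (cong (ℤ._* ℤ.+ 1) (trans (ℤ.pos-+ a b) (sym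
                                       (cong₂ ℤ._+_ (ℤ.*-identityʳ (ℤ.+ a)) (ℤ.*-identityʳ (ℤ.+ b)))))) ⟩
  mkℚᵘ (ℤ.+ a) 0 ℚᵘ.+ mkℚᵘ (ℤ.+ b) 0  ≈⟨ ℚᵘ.+-cong (ℚᵘ.≃-sym (toℚᵘ-fromℚᵘ (mkℚᵘ (ℤ.+ a) 0)))
                                                 (ℚᵘ.≃-sym (toℚᵘ-fromℚᵘ (mkℚᵘ (ℤ.+ b) 0))) ⟩
  toℚᵘ (ℕ→ℚ a) ℚᵘ.+ toℚᵘ (ℕ→ℚ b)  ≈⟨ ℚᵘ.≃-sym (toℚᵘ-homo-+ (ℕ→ℚ a) (ℕ→ℚ b)) ⟩
  toℚᵘ (ℕ→ℚ a + ℕ→ℚ b)            ∎)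
  where open ℚᵘ.≃-Reasoning

0≤+ : ∀ {p q} → 0ℚ ≤ p → 0ℚ ≤ q → 0ℚ ≤ p + q
0≤+ {p} {q} 0≤p 0≤q = subst (_≤ p + q) (+-identityʳ 0ℚ) (+-mono-≤ 0≤p 0≤q)

0≤* : ∀ {p q} → 0ℚ ≤ p → 0ℚ ≤ q → 0ℚ ≤ p * q
0≤* {p} {q} 0≤p 0≤q =
  nonNegative⁻¹ (p * q) {{nonNeg*nonNeg⇒nonNeg p {{ℚ.nonNegative 0≤p}} q {{ℚ.nonNegative 0≤q}}}}

0≤∧+≡0⇒≡0 : ∀ {p q} → 0ℚ ≤ p → 0ℚ ≤ q → p + q ≡ 0ℚ → p ≡ 0ℚ × q ≡ 0ℚ
0≤∧+≡0⇒≡0 {p} {q} 0≤p 0≤q p+q≡0 = ≤-antisym p≤0 0≤p , ≤-antisym q≤0 0≤q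
  where
  p≤0 : p ≤ 0ℚ
  p≤0 = subst₂ _≤_ (+-identityʳ p) p+q≡0 (+-monoʳ-≤ p 0≤q)
  q≤0 : q ≤ 0ℚ
  q≤0 = subst₂ _≤_ (+-identityˡ q) p+q≡0 (+-monoˡ-≤ q 0≤p)

0≤⇒≡0⊎0< : ∀ {p} → 0ℚ ≤ p → p ≡ 0ℚ ⊎ 0ℚ < p
0≤⇒≡0⊎0< {p} 0≤p with <-cmp 0ℚ p
... | tri< 0<p _ _ = inj₂ 0<p
... | tri≈ _ 0≡p _ = inj₁ (sym 0≡p)
... | tri> _ _ p<0 = ⊥-elim (<-irrefl refl (≤-<-trans 0≤p p<0))

-- Opaque because, unfolded, ℕ→ℚ normalises and ⟦ y ⟧ j no longer determines y in unification.
opaque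
  ⟦_⟧ : Point n → Vector ℚ n
  ⟦ x ⟧ j = ℕ→ℚ (x j)

  ⟦⟧-cong : {x y : Point n} → x ≗ y → ⟦ x ⟧ ≗ ⟦ y ⟧
  ⟦⟧-cong x≗y j = cong ℕ→ℚ (x≗y j)

  ⟦⟧-+ᵥ : (a b : Point n) → ⟦ a +ᵥ b ⟧ ≗ λ j → ⟦ a ⟧ j + ⟦ b ⟧ j
  ⟦⟧-+ᵥ a b j = ℕ→ℚ-+ (a j) (b j)

_⊞_ : List (Point n) → List (Point n) → List (Point n)
_⊞_ = cartesianProductWith _+ᵥ_

∈-⊞⁻ : (as bs : List (Point n)) {x : Point n} → x ∈ as ⊞ bs → ∃₂ λ a b → a ∈ as × b ∈ bs × x ≡ a +ᵥ b
∈-⊞⁻ = ∈-cartesianProductWith⁻ _+ᵥ_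

∈-⊞⁺ : {as bs : List (Point n)} {a b : Point n} → a ∈ as → b ∈ bs → a +ᵥ b ∈ as ⊞ bs
∈-⊞⁺ = ∈-cartesianProductWith⁺ _+ᵥ_

infix 4 _⊆≗_

_⊆≗_ : List (Point n) → List (Point n) → Set
gs ⊆≗ hs = ∀ {x} → x ∈ gs → ∃ λ y → y ∈ hs × x ≗ y

⊞-comm : (as bs : List (Point n)) → as ⊞ bs ⊆≗ bs ⊞ as
⊞-comm as bs x∈ with ∈-⊞⁻ as bs x∈
... | a , b , a∈ , b∈ , refl = b +ᵥ a , ∈-⊞⁺ b∈ a∈ , λ j → ℕ.+-comm (a j) (b j)

⊞-assocˡ : (as bs cs : List (Point n)) → (as ⊞ bs) ⊞ cs ⊆≗ as ⊞ (bs ⊞ cs)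
⊞-assocˡ as bs cs x∈ with ∈-⊞⁻ (as ⊞ bs) cs x∈
... | _ , c , ab∈ , c∈ , refl with ∈-⊞⁻ as bs ab∈
...   | a , b , a∈ , b∈ , refl = a +ᵥ (b +ᵥ c) , ∈-⊞⁺ a∈ (∈-⊞⁺ b∈ c∈) , λ j → ℕ.+-assoc (a j) (b j) (c j)

⊞-assocʳ : (as bs cs : List (Point n)) → as ⊞ (bs ⊞ cs) ⊆≗ (as ⊞ bs) ⊞ cs
⊞-assocʳ as bs cs x∈ with ∈-⊞⁻ as (bs ⊞ cs) x∈
... | a , _ , a∈ , bc∈ , refl with ∈-⊞⁻ bs cs bc∈
...   | b , c , b∈ , c∈ , refl = (a +ᵥ b) +ᵥ c , ∈-⊞⁺ (∈-⊞⁺ a∈ b∈) c∈ , λ j → sym (ℕ.+-assoc (a j) (b j) (c j))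

⊞-distribˡ-++ : (vs as bs : List (Point n)) → vs ⊞ (as ++ bs) ⊆ vs ⊞ as ++ vs ⊞ bs
⊞-distribˡ-++ vs as bs x∈ with ∈-⊞⁻ vs (as ++ bs) x∈
... | v , y , v∈ , y∈ , refl with ∈-++⁻ as y∈
...   | inj₁ a∈ = ∈-++⁺ˡ (∈-⊞⁺ v∈ a∈)
...   | inj₂ b∈ = ∈-++⁺ʳ (vs ⊞ as) (∈-⊞⁺ v∈ b∈)

⊞-factorˡ-++ : (vs as bs : List (Point n)) → vs ⊞ as ++ vs ⊞ bs ⊆ vs ⊞ (as ++ bs)
⊞-factorˡ-++ vs as bs x∈ with ∈-++⁻ (vs ⊞ as) x∈
... | inj₁ x∈vs⊞as with ∈-⊞⁻ vs as x∈vs⊞as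
...   | v , a , v∈ , a∈ , refl = ∈-⊞⁺ v∈ (∈-++⁺ˡ a∈)
⊞-factorˡ-++ vs as bs x∈ | inj₂ x∈vs⊞bs with ∈-⊞⁻ vs bs x∈vs⊞bs
...   | v , b , v∈ , b∈ , refl = ∈-⊞⁺ v∈ (∈-++⁺ʳ as b∈)

-- Nonnegative combinations

record Comb (gs : List (Point n)) (m : ℚ) (w : Vector ℚ n) : Set where
  constructor comb
  field
    entries : List (ℚ × Point n)
    valid   : All (λ c → 0ℚ ≤ proj₁ c × proj₂ c ∈ gs) entries
    weight  : sumℚ (List.map proj₁ entries) ≡ m
    moment  : (λ j → sumℚ (List.map (λ c → proj₁ c * ⟦ proj₂ c ⟧ j) entries)) ≗ w

comb-[] : {gs : List (Point n)} → Comb gs 0ℚ (λ _ → 0ℚ)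
comb-[] = comb [] [] refl (λ _ → refl)

comb-∷ : ∀ {gs : List (Point n)} {l x m w} → 0ℚ ≤ l → x ∈ gs → Comb gs m w →
         Comb gs (l + m) (λ j → l * ⟦ x ⟧ j + w j)
comb-∷ {l = l} {x} 0≤l x∈gs (comb cs valid refl moment) =
  comb ((l , x) ∷ cs) ((0≤l , x∈gs) ∷ valid) refl (λ j → cong (l * ⟦ x ⟧ j +_) (moment j))

comb-cong : ∀ {gs : List (Point n)} {m m' w w'} → m ≡ m' → w ≗ w' → Comb gs m w → Comb gs m' w'
comb-cong refl w≗w' (comb cs valid weight moment) = comb cs valid weight (λ j → trans (moment j) (w≗w' j))

module _ {gs : List (Point n)} (P : ℚ → Vector ℚ n → Set)
         (P-cong : ∀ {m w w'} → w ≗ w' → P m w → P m w')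
         (P-[] : P 0ℚ (λ _ → 0ℚ))
         (P-∷ : ∀ {l x m w} → 0ℚ ≤ l → x ∈ gs → P m w → P (l + m) (λ j → l * ⟦ x ⟧ j + w j))
         where

  comb-rec : ∀ {m w} → Comb gs m w → P m w
  comb-rec (comb cs valid refl moment) = P-cong moment (go cs valid)
    where
    go : ∀ cs → All (λ c → 0ℚ ≤ proj₁ c × proj₂ c ∈ gs) cs →
         P (sumℚ (List.map proj₁ cs)) (λ j → sumℚ (List.map (λ c → proj₁ c * ⟦ proj₂ c ⟧ j) cs))
    go []            []                    = P-[]
    go ((l , x) ∷ cs) ((0≤l , x∈gs) ∷ valid) = P-∷ 0≤l x∈gs (go cs valid)

module _ {gs : List (Point n)} where

  comb-+ : ∀ {m m' w w'} → Comb gs m w → Comb gs m' w' → Comb gs (m + m') (λ j → w j + w' j)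
  comb-+ {m' = m'} {w' = w'} C C' = comb-rec (λ m w → Comb gs (m + m') (λ j → w j + w' j))
    (λ w≗ → comb-cong refl (λ j → cong (_+ w' j) (w≗ j)))
    (comb-cong (sym (+-identityˡ m')) (λ j → sym (+-identityˡ (w' j))) C')
    (λ {l} {x} {m} {w} 0≤l x∈gs C″ →
      comb-cong (sym (+-assoc l m m')) (λ j → sym (+-assoc (l * ⟦ x ⟧ j) (w j) (w' j))) (comb-∷ 0≤l x∈gs C″))
    C

  comb-scale : ∀ {m w} α → 0ℚ ≤ α → Comb gs m w → Comb gs (α * m) (λ j → α * w j)
  comb-scale α 0≤α = comb-rec (λ m w → Comb gs (α * m) (λ j → α * w j))
    (λ w≗ → comb-cong refl (λ j → cong (α *_) (w≗ j)))
    (comb-cong (sym (*-zeroʳ α)) (λ _ → sym (*-zeroʳ α)) comb-[])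
    (λ {l} {x} {m} {w} 0≤l x∈gs C →
      comb-cong (sym (*-distribˡ-+ α l m))
        (λ j → trans (cong (_+ α * w j) (*-assoc α l (⟦ x ⟧ j))) (sym (*-distribˡ-+ α _ (w j))))
        (comb-∷ (0≤* 0≤α 0≤l) x∈gs C))

  comb-point : ∀ {x y} → y ∈ gs → x ≗ y → Comb gs 1ℚ ⟦ x ⟧
  comb-point {x} y∈gs x≗y = comb-cong (+-identityʳ 1ℚ)
    (λ j → trans (+-identityʳ _) (trans (*-identityˡ _) (sym (⟦⟧-cong x≗y j))))
    (comb-∷ (nonNegative⁻¹ 1ℚ) y∈gs comb-[])

  comb-weight-nonneg : ∀ {m w} → Comb gs m w → 0ℚ ≤ m
  comb-weight-nonneg = comb-rec (λ m _ → 0ℚ ≤ m) (λ _ → id) ≤-refl (λ 0≤l _ → 0≤+ 0≤l)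

  comb-weight-0⇒moment-0 : ∀ {w} → Comb gs 0ℚ w → w ≗ (λ _ → 0ℚ)
  comb-weight-0⇒moment-0 C = proj₂ (comb-rec (λ m w → 0ℚ ≤ m × (m ≡ 0ℚ → w ≗ (λ _ → 0ℚ)))
    (λ w≗w' (0≤m , h) → 0≤m , λ m≡0 j → trans (sym (w≗w' j)) (h m≡0 j))
    (≤-refl , λ _ _ → refl)
    (λ {l} {x} 0≤l _ (0≤m , h) → 0≤+ 0≤l 0≤m , λ l+m≡0 j →
      let l≡0 , m≡0 = 0≤∧+≡0⇒≡0 0≤l 0≤m l+m≡0 in
      trans (cong₂ _+_ (trans (cong (_* ⟦ x ⟧ j) l≡0) (*-zeroˡ (⟦ x ⟧ j))) (h m≡0 j)) (+-identityʳ 0ℚ))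
    C) refl

comb-bind : ∀ {gs hs : List (Point n)} {m w} → (∀ {x} → x ∈ gs → Comb hs 1ℚ ⟦ x ⟧) →
            Comb gs m w → Comb hs m w
comb-bind {hs = hs} f = comb-rec (Comb hs) (comb-cong refl) comb-[]
  (λ {l} {x} {m} 0≤l x∈gs C → comb-cong (cong (_+ m) (*-identityʳ l)) (λ _ → refl)
                                 (comb-+ (comb-scale l 0≤l (f x∈gs)) C))

comb-[]⇒weight-0 : ∀ {m w} → Comb {n} [] m w → m ≡ 0ℚ
comb-[]⇒weight-0 (comb [] [] weight _)             = sym weight
comb-[]⇒weight-0 (comb (_ ∷ _) ((_ , ()) ∷ _) _ _)

comb-uncons : ∀ {v : Point n} {vs m w} → Comb (v ∷ vs) m w →
              ∃₂ λ μ m' → ∃ λ w' → 0ℚ ≤ μ × Comb vs m' w' × m ≡ μ + m' × w ≗ (λ j → μ * ⟦ v ⟧ j + w' j)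
comb-uncons {n} {v} {vs} = comb-rec P P-cong P-[] P-∷
  where
  P : ℚ → Vector ℚ n → Set
  P m w = ∃₂ λ μ m' → ∃ λ w' → 0ℚ ≤ μ × Comb vs m' w' × m ≡ μ + m' × w ≗ (λ j → μ * ⟦ v ⟧ j + w' j)
  P-cong : ∀ {m w w'} → w ≗ w' → P m w → P m w'
  P-cong w≗w' (μ , m' , w″ , 0≤μ , C , m≡ , w≗) = μ , m' , w″ , 0≤μ , C , m≡ , λ j → trans (sym (w≗w' j)) (w≗ j)
  P-[] : P 0ℚ (λ _ → 0ℚ)
  P-[] = 0ℚ , 0ℚ , (λ _ → 0ℚ) , ≤-refl , comb-[] , sym (+-identityʳ 0ℚ) ,
         λ j → sym (trans (+-identityʳ _) (*-zeroˡ (⟦ v ⟧ j)))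
  P-∷ : ∀ {l x m w} → 0ℚ ≤ l → x ∈ v ∷ vs → P m w → P (l + m) (λ j → l * ⟦ x ⟧ j + w j)
  P-∷ {l} 0≤l (here refl) (μ , m' , w' , 0≤μ , C , m≡ , w≗) =
    l + μ , m' , w' , 0≤+ 0≤l 0≤μ , C , trans (cong (l +_) m≡) (sym (+-assoc l μ m')) ,
    λ j → trans (cong (l * ⟦ v ⟧ j +_) (w≗ j))
                (trans (sym (+-assoc (l * ⟦ v ⟧ j) (μ * ⟦ v ⟧ j) (w' j)))
                       (cong (_+ w' j) (sym (*-distribʳ-+ (⟦ v ⟧ j) l μ))))
  P-∷ {l} {x} 0≤l (there x∈vs) (μ , m' , w' , 0≤μ , C , m≡ , w≗) =
    μ , l + m' , (λ j → l * ⟦ x ⟧ j + w' j) , 0≤μ , comb-∷ 0≤l x∈vs C ,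
    trans (cong (l +_) m≡) (swap l μ m') ,
    λ j → trans (cong (l * ⟦ x ⟧ j +_) (w≗ j)) (swap (l * ⟦ x ⟧ j) (μ * ⟦ v ⟧ j) (w' j))
    where
    swap : ∀ a b c → a + (b + c) ≡ b + (a + c)
    swap = solve 3 (λ a b c → a :+ (b :+ c) := b :+ (a :+ c)) refl

comb-translate : ∀ {as bs : List (Point n)} {a m y} → a ∈ as → Comb bs m y →
                 Comb (as ⊞ bs) m (λ j → m * ⟦ a ⟧ j + y j)
comb-translate {as = as} {bs} {a} a∈as = comb-rec (λ m y → Comb (as ⊞ bs) m (λ j → m * ⟦ a ⟧ j + y j))
  (λ {m} y≗ → comb-cong refl (λ j → cong (m * ⟦ a ⟧ j +_) (y≗ j)))
  (comb-cong refl (λ j → sym (trans (+-identityʳ _) (*-zeroˡ (⟦ a ⟧ j)))) comb-[])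
  (λ {l} {b} {m} {y} 0≤l b∈bs C → comb-cong refl
    (λ j → begin
      l * ⟦ a +ᵥ b ⟧ j + (m * ⟦ a ⟧ j + y j)       ≡⟨ cong (λ t → l * t + (m * ⟦ a ⟧ j + y j)) (⟦⟧-+ᵥ a b j) ⟩
      l * (⟦ a ⟧ j + ⟦ b ⟧ j) + (m * ⟦ a ⟧ j + y j) ≡⟨ regroup l m (⟦ a ⟧ j) (⟦ b ⟧ j) (y j) ⟩
      (l + m) * ⟦ a ⟧ j + (l * ⟦ b ⟧ j + y j)       ∎)
    (comb-∷ 0≤l (∈-⊞⁺ a∈as b∈bs) C))
  where
  open ≡-Reasoning
  regroup : ∀ l m a b y → l * (a + b) + (m * a + y) ≡ (l + m) * a + (l * b + y)
  regroup = solve 5 (λ l m a b y → l :* (a :+ b) :+ (m :* a :+ y) := (l :+ m) :* a :+ (l :* b :+ y)) refl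

comb-⊞ : ∀ {as bs : List (Point n)} {m x y} → Comb as m x → Comb bs 1ℚ y →
         Comb (as ⊞ bs) m (λ j → x j + m * y j)
comb-⊞ {as = as} {bs} {y = y} C D = comb-rec (λ m x → Comb (as ⊞ bs) m (λ j → x j + m * y j))
  (λ {m} x≗ → comb-cong refl (λ j → cong (_+ m * y j) (x≗ j)))
  (comb-cong refl (λ j → sym (trans (+-identityˡ _) (*-zeroˡ (y j)))) comb-[])
  (λ {l} {a} {m} {x} 0≤l a∈as C′ → comb-cong (cong (_+ m) (*-identityʳ l))
    (λ j → regroup l m (⟦ a ⟧ j) (x j) (y j))
    (comb-+ (comb-scale l 0≤l (comb-translate a∈as D)) C′))
  C
  where
  regroup : ∀ l m a x y → l * (1ℚ * a + y) + (x + m * y) ≡ (l * a + x) + (l + m) * y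
  regroup = solve 5 (λ l m a x y → l :* (con 1ℚ :* a :+ y) :+ (x :+ m :* y) := (l :* a :+ x) :+ (l :+ m) :* y) refl

comb-⊞⁻ : ∀ {as bs : List (Point n)} {m z} → Comb (as ⊞ bs) m z →
          ∃₂ λ x y → Comb as m x × Comb bs m y × z ≗ (λ j → x j + y j)
comb-⊞⁻ {n} {as} {bs} = comb-rec P P-cong P-[] P-∷
  where
  P : ℚ → Vector ℚ n → Set
  P m z = ∃₂ λ x y → Comb as m x × Comb bs m y × z ≗ (λ j → x j + y j)
  P-cong : ∀ {m z z'} → z ≗ z' → P m z → P m z'
  P-cong z≗z' (x , y , C , D , z≗) = x , y , C , D , λ j → trans (sym (z≗z' j)) (z≗ j)
  P-[] : P 0ℚ (λ _ → 0ℚ)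
  P-[] = (λ _ → 0ℚ) , (λ _ → 0ℚ) , comb-[] , comb-[] , λ _ → sym (+-identityʳ 0ℚ)
  P-∷ : ∀ {l v m z} → 0ℚ ≤ l → v ∈ as ⊞ bs → P m z → P (l + m) (λ j → l * ⟦ v ⟧ j + z j)
  P-∷ {l} 0≤l v∈as⊞bs (x , y , C , D , z≗) with ∈-⊞⁻ as bs v∈as⊞bs
  ... | a , b , a∈as , b∈bs , refl =
    (λ j → l * ⟦ a ⟧ j + x j) , (λ j → l * ⟦ b ⟧ j + y j) , comb-∷ 0≤l a∈as C , comb-∷ 0≤l b∈bs D ,
    λ j → trans (cong₂ (λ s t → l * s + t) (⟦⟧-+ᵥ a b j) (z≗ j)) (regroup l (⟦ a ⟧ j) (⟦ b ⟧ j) (x j) (y j))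
    where
    regroup : ∀ l a b x y → l * (a + b) + (x + y) ≡ (l * a + x) + (l * b + y)
    regroup = solve 5 (λ l a b x y → l :* (a :+ b) :+ (x :+ y) := (l :* a :+ x) :+ (l :* b :+ y)) refl

-- Cancellation

drop-common-term : ∀ a μ d v k w → a + (μ + d) * v ≡ k + (μ * v + w) → a + d * v ≡ k + w
drop-common-term a μ d v k w eq = begin
  a + d * v                      ≡⟨ regroup₁ a μ d v ⟩
  a + (μ + d) * v - μ * v        ≡⟨ cong (_- μ * v) eq ⟩
  k + (μ * v + w) - μ * v        ≡⟨ regroup₂ k (μ * v) w ⟩
  k + w                          ∎
  where
  open ≡-Reasoning
  regroup₁ : ∀ a μ d v → a + d * v ≡ a + (μ + d) * v - μ * v
  regroup₁ = solve 4 (λ a μ d v → a :+ d :* v := a :+ (μ :+ d) :* v :- μ :* v) refl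
  regroup₂ : ∀ k u w → k + (u + w) - u ≡ k + w
  regroup₂ = solve 3 (λ k u w → k :+ (u :+ w) :- u := k :+ w) refl

eliminate-pivot : ∀ a c y k μ v w k₀ w₀ d ι →
  a + c * y ≡ k + (μ * v + w) → a + d * v ≡ k₀ + w₀ → ι * (d + μ) ≡ 1ℚ →
  a + (ι * (d * c)) * y ≡ (ι * d) * k + (ι * μ) * k₀ + ι * (μ * w₀ + d * w)
eliminate-pivot a c y k μ v w k₀ w₀ d ι row pivot ι[d+μ]≡1 = begin
  a + (ι * (d * c)) * y                                   ≡⟨ cong (_+ (ι * (d * c)) * y) (*-identityˡ a) ⟨
  1ℚ * a + (ι * (d * c)) * y                              ≡⟨ cong (λ t → t * a + (ι * (d * c)) * y) ι[d+μ]≡1 ⟨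
  ι * (d + μ) * a + (ι * (d * c)) * y                     ≡⟨ regroup₁ a c y μ v d ι ⟩
  ι * (d * (a + c * y) + μ * (a + d * v) - μ * d * v)
    ≡⟨ cong₂ (λ s t → ι * (d * s + μ * t - μ * d * v)) row pivot ⟩
  ι * (d * (k + (μ * v + w)) + μ * (k₀ + w₀) - μ * d * v) ≡⟨ regroup₂ k μ v w k₀ w₀ d ι ⟩
  (ι * d) * k + (ι * μ) * k₀ + ι * (μ * w₀ + d * w)       ∎
  where
  open ≡-Reasoning
  regroup₁ : ∀ a c y μ v d ι →
    ι * (d + μ) * a + (ι * (d * c)) * y ≡ ι * (d * (a + c * y) + μ * (a + d * v) - μ * d * v)
  regroup₁ = solve 7 (λ a c y μ v d ι →
    ι :* (d :+ μ) :* a :+ (ι :* (d :* c)) :* y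
      := ι :* (d :* (a :+ c :* y) :+ μ :* (a :+ d :* v) :- μ :* d :* v)) refl
  regroup₂ : ∀ k μ v w k₀ w₀ d ι →
    ι * (d * (k + (μ * v + w)) + μ * (k₀ + w₀) - μ * d * v)
      ≡ (ι * d) * k + (ι * μ) * k₀ + ι * (μ * w₀ + d * w)
  regroup₂ = solve 8 (λ k μ v w k₀ w₀ d ι →
    ι :* (d :* (k :+ (μ :* v :+ w)) :+ μ :* (k₀ :+ w₀) :- μ :* d :* v)
      := (ι :* d) :* k :+ (ι :* μ) :* k₀ :+ ι :* (μ :* w₀ :+ d :* w)) refl

Decomposes : List (Point n) → List (Point n) → Vector ℚ n → Point n → Set
Decomposes {n} bs L a y =
  ∃₂ λ c k → ∃ λ w → Comb bs 1ℚ k × Comb L c w × (∀ j → a j + c * ⟦ y ⟧ j ≡ k j + w j)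

module _ {bs : List (Point n)} {a : Vector ℚ n} where

  drop-pivot : ∀ {v vs} → Decomposes bs (v ∷ vs) a v → Decomposes bs vs a v
  drop-pivot {v} (c , k , w , K , W , E) with comb-uncons W
  ... | μ , d , w' , _ , W' , c≡μ+d , w≗ = d , k , w' , K , W' , λ j →
    drop-common-term (a j) μ d (⟦ v ⟧ j) (k j) (w' j)
      (trans (cong (λ t → a j + t * ⟦ v ⟧ j) (sym c≡μ+d)) (trans (E j) (cong (k j +_) (w≗ j))))

  degenerate : ∀ {L y} (D : Decomposes bs L a y) → proj₁ D ≡ 0ℚ → Comb bs 1ℚ a
  degenerate {y = y} (c , k , w , K , W , E) refl = comb-cong refl (λ j → begin
    k j             ≡⟨ +-identityʳ (k j) ⟨
    k j + 0ℚ        ≡⟨ cong (k j +_) (comb-weight-0⇒moment-0 W j) ⟨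
    k j + w j       ≡⟨ E j ⟨
    a j + 0ℚ * ⟦ y ⟧ j ≡⟨ cong (a j +_) (*-zeroˡ (⟦ y ⟧ j)) ⟩
    a j + 0ℚ        ≡⟨ +-identityʳ (a j) ⟩
    a j             ∎) K
    where open ≡-Reasoning

  -- Substitute the pivot row a + d·v = k₀ + w₀ for the μ·v in the row of y, then divide by d + μ.
  eliminate : ∀ {v vs y} (D : Decomposes bs vs a v) → 0ℚ < proj₁ D →
              Decomposes bs (v ∷ vs) a y → Decomposes bs vs a y
  eliminate {v} {vs} {y} (d , k₀ , w₀ , K₀ , W₀ , E₀) 0<d (c , k , w , K , W , E) with comb-uncons W
  ... | μ , m , w' , 0≤μ , W' , c≡μ+m , w≗ =
    ι * (d * c) , (λ j → (ι * d) * k j + (ι * μ) * k₀ j) , (λ j → ι * (μ * w₀ j + d * w' j)) ,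
    comb-cong (trans (cong₂ _+_ (*-identityʳ (ι * d)) (*-identityʳ (ι * μ)))
                     (trans (sym (*-distribˡ-+ ι d μ)) ι[d+μ]≡1))
      (λ _ → refl) (comb-+ (comb-scale (ι * d) (0≤* 0≤ι 0≤d) K) (comb-scale (ι * μ) (0≤* 0≤ι 0≤μ) K₀)) ,
    comb-cong (cong (ι *_) (trans (regroup d μ m) (cong (d *_) (sym c≡μ+m)))) (λ _ → refl)
      (comb-scale ι 0≤ι (comb-+ (comb-scale μ 0≤μ W₀) (comb-scale d 0≤d W'))) ,
    λ j → eliminate-pivot (a j) c (⟦ y ⟧ j) (k j) μ (⟦ v ⟧ j) (w' j) (k₀ j) (w₀ j) d ι
            (trans (E j) (cong (k j +_) (w≗ j))) (E₀ j) ι[d+μ]≡1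
    where
    0≤d : 0ℚ ≤ d
    0≤d = <⇒≤ 0<d
    instance
      d+μ-positive : ℚ.Positive (d + μ)
      d+μ-positive = ℚ.positive (subst (_< d + μ) (+-identityʳ 0ℚ) (+-mono-<-≤ 0<d 0≤μ))
      d+μ-nonZero : ℚ.NonZero (d + μ)
      d+μ-nonZero = pos⇒nonZero (d + μ)
    ι : ℚ
    ι = 1/ (d + μ)
    ι[d+μ]≡1 : ι * (d + μ) ≡ 1ℚ
    ι[d+μ]≡1 = *-inverseˡ (d + μ)
    0≤ι : 0ℚ ≤ ι
    0≤ι = <⇒≤ (positive⁻¹ ι {{1/pos⇒pos (d + μ)}})
    regroup : ∀ d μ m → μ * d + d * m ≡ d * (μ + m)
    regroup = solve 3 (λ d μ m → μ :* d :+ d :* m := d :* (μ :+ m)) refl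

  coefficient-nonneg : ∀ {L y} (D : Decomposes bs L a y) → 0ℚ ≤ proj₁ D
  coefficient-nonneg (_ , _ , _ , _ , W , _) = comb-weight-nonneg W

  decomposable⇒comb : ∀ v vs → All (Decomposes bs (v ∷ vs) a) (v ∷ vs) → Comb bs 1ℚ a
  decomposable-pivot⇒comb : ∀ {v} vs (D : Decomposes bs vs a v) → 0ℚ < proj₁ D →
                    All (Decomposes bs (v ∷ vs) a) vs → Comb bs 1ℚ a

  decomposable⇒comb v vs (D ∷ Ds) = [ degenerate D′ , (λ 0<c → decomposable-pivot⇒comb vs D′ 0<c Ds) ]′
                           (0≤⇒≡0⊎0< (coefficient-nonneg D′))
    where D′ = drop-pivot D

  decomposable-pivot⇒comb []       (_ , _ , _ , _ , W , _) 0<c _  =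
    ⊥-elim (<⇒≢ 0<c (sym (comb-[]⇒weight-0 W)))
  decomposable-pivot⇒comb (u ∷ us) D                       0<c Ds =
    decomposable⇒comb u us (All.map (eliminate D 0<c) Ds)

infix 4 _⊑ᴸ_

_⊑ᴸ_ : List (Point n) → List (Point n) → Set
gs ⊑ᴸ hs = All (λ x → Comb hs 1ℚ ⟦ x ⟧) gs

comb-⊆ : ∀ {gs hs : List (Point n)} {m w} → gs ⊆ hs → Comb gs m w → Comb hs m w
comb-⊆ gs⊆hs = comb-bind (λ x∈gs → comb-point (gs⊆hs x∈gs) (λ _ → refl))

⊆≗⇒⊑ᴸ : {gs hs : List (Point n)} → gs ⊆≗ hs → gs ⊑ᴸ hs
⊆≗⇒⊑ᴸ gs⊆≗hs = All.tabulate (λ x∈gs → let y , y∈hs , x≗y = gs⊆≗hs x∈gs in comb-point y∈hs x≗y)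

⊆⇒⊑ᴸ : {gs hs : List (Point n)} → gs ⊆ hs → gs ⊑ᴸ hs
⊆⇒⊑ᴸ gs⊆hs = ⊆≗⇒⊑ᴸ (λ {x} x∈gs → x , gs⊆hs x∈gs , λ _ → refl)

⊑ᴸ-refl : (gs : List (Point n)) → gs ⊑ᴸ gs
⊑ᴸ-refl gs = ⊆⇒⊑ᴸ id

⊑ᴸ-trans : {gs hs ks : List (Point n)} → gs ⊑ᴸ hs → hs ⊑ᴸ ks → gs ⊑ᴸ ks
⊑ᴸ-trans gs⊑hs hs⊑ks = All.map (comb-bind (All.lookup hs⊑ks)) gs⊑hs

++-mono-⊑ᴸ : {as bs as' bs' : List (Point n)} → as ⊑ᴸ as' → bs ⊑ᴸ bs' → as ++ bs ⊑ᴸ as' ++ bs'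
++-mono-⊑ᴸ {as' = as'} as⊑as' bs⊑bs' =
  AllP.++⁺ (All.map (comb-⊆ ∈-++⁺ˡ) as⊑as') (All.map (comb-⊆ (∈-++⁺ʳ as')) bs⊑bs')

⊞-mono-⊑ᴸ : {as bs as' bs' : List (Point n)} → as ⊑ᴸ as' → bs ⊑ᴸ bs' → as ⊞ bs ⊑ᴸ as' ⊞ bs'
⊞-mono-⊑ᴸ {as = as} {bs} as⊑as' bs⊑bs' = All.tabulate point
  where
  point : ∀ {x} → x ∈ as ⊞ bs → Comb _ 1ℚ ⟦ x ⟧
  point x∈as⊞bs with ∈-⊞⁻ as bs x∈as⊞bs
  ... | a , b , a∈as , b∈bs , refl =
    comb-cong refl (λ j → trans (cong (⟦ a ⟧ j +_) (*-identityˡ (⟦ b ⟧ j))) (sym (⟦⟧-+ᵥ a b j)))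
      (comb-⊞ (All.lookup as⊑as' a∈as) (All.lookup bs⊑bs' b∈bs))

⊞-cancelˡ-⊑ᴸ : ∀ (v : Point n) vs {as bs} → (v ∷ vs) ⊞ as ⊑ᴸ (v ∷ vs) ⊞ bs → as ⊑ᴸ bs
⊞-cancelˡ-⊑ᴸ v vs {as} {bs} sum⊑sum =
  All.tabulate (λ x∈as → decomposable⇒comb v vs (All.tabulate (decompose x∈as)))
  where
  decompose : ∀ {x y} → x ∈ as → y ∈ v ∷ vs → Decomposes bs (v ∷ vs) ⟦ x ⟧ y
  decompose {x} {y} x∈as y∈vs with comb-⊞⁻ (All.lookup sum⊑sum (∈-⊞⁺ y∈vs x∈as))
  ... | u , k , U , K , y+x≗u+k =
    1ℚ , k , u , K , U , λ j → begin
      ⟦ x ⟧ j + 1ℚ * ⟦ y ⟧ j ≡⟨ cong (⟦ x ⟧ j +_) (*-identityˡ (⟦ y ⟧ j)) ⟩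
      ⟦ x ⟧ j + ⟦ y ⟧ j      ≡⟨ +-comm (⟦ x ⟧ j) (⟦ y ⟧ j) ⟩
      ⟦ y ⟧ j + ⟦ x ⟧ j      ≡⟨ ⟦⟧-+ᵥ y x j ⟨
      ⟦ y +ᵥ x ⟧ j           ≡⟨ y+x≗u+k j ⟩
      u j + k j              ≡⟨ +-comm (u j) (k j) ⟩
      k j + u j              ∎
    where open ≡-Reasoning

gens : 𝒜 n → List (Point n)
gens nothing  = []
gens (just p) = toList p

gens-⊙ : (X Y : 𝒜 n) → gens (X ⊙ Y) ≡ gens X ⊞ gens Y
gens-⊙ nothing  _        = refl
gens-⊙ (just p) nothing  = sym (cartesianProductWith-zeroʳ _+ᵥ_ (toList p))
gens-⊙ (just (a List⁺.∷ as)) (just q) = cong (List.map (a +ᵥ_) (toList q) ++_) (concat-rows as)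
  where
  concat-rows : ∀ xs →
    List.concat (List.map toList (List.map (λ x → List⁺.map (x +ᵥ_) q) xs)) ≡ xs ⊞ toList q
  concat-rows []       = refl
  concat-rows (x ∷ xs) = cong (List.map (x +ᵥ_) (toList q) ++_) (concat-rows xs)

gens-⊕ : (X Y : 𝒜 n) → gens (X ⊕ Y) ≡ gens X ++ gens Y
gens-⊕ nothing  _        = refl
gens-⊕ (just p) nothing  = sym (++-identityʳ (toList p))
gens-⊕ (just (_ List⁺.∷ _)) (just (_ List⁺.∷ _)) = refl

opaque
  unfolding ⟦_⟧

  InConv⇒Comb : ∀ {x : Point n} {p} → InConv x p → Comb (toList p) 1ℚ ⟦ x ⟧
  InConv⇒Comb (cs , valid , weight , moment) = comb cs (All.map (map₂ (Any.map sym)) valid) weight moment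

  Comb⇒InConv : ∀ {x : Point n} {p} → Comb (toList p) 1ℚ ⟦ x ⟧ → InConv x p
  Comb⇒InConv (comb cs valid weight moment) = cs , All.map (map₂ (Any.map sym)) valid , weight , moment

⊑⇒⊑ᴸ : (X Y : 𝒜 n) → X ⊑ Y → gens X ⊑ᴸ gens Y
⊑⇒⊑ᴸ nothing  _        _   = []
⊑⇒⊑ᴸ (just p) (just q) p⊑q = All.map InConv⇒Comb p⊑q

⊑ᴸ⇒⊑ : (X Y : 𝒜 n) → gens X ⊑ᴸ gens Y → X ⊑ Y
⊑ᴸ⇒⊑ nothing                _        _          = _
⊑ᴸ⇒⊑ (just (_ List⁺.∷ _)) nothing  (C ∷ _)    = ⊥-elim (1≢0 (comb-[]⇒weight-0 C))
⊑ᴸ⇒⊑ (just p)              (just q) p⊑ᴸq       = All.map Comb⇒InConv p⊑ᴸq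

⊑-via-gens : ∀ (X Y : 𝒜 n) {gs hs} → gens X ≡ gs → gens Y ≡ hs → gs ⊑ᴸ hs → X ⊑ Y
⊑-via-gens X Y refl refl = ⊑ᴸ⇒⊑ X Y

⊑-refl : (X : 𝒜 n) → X ⊑ X
⊑-refl X = ⊑ᴸ⇒⊑ X X (⊑ᴸ-refl (gens X))

⊑-trans : (X Y Z : 𝒜 n) → X ⊑ Y → Y ⊑ Z → X ⊑ Z
⊑-trans X Y Z X⊑Y Y⊑Z = ⊑ᴸ⇒⊑ X Z (⊑ᴸ-trans (⊑⇒⊑ᴸ X Y X⊑Y) (⊑⇒⊑ᴸ Y Z Y⊑Z))

≈-refl : (X : 𝒜 n) → X ≈ X
≈-refl X = ⊑-refl X , ⊑-refl X

≈-isEquivalence : IsEquivalence (_≈_ {n})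
≈-isEquivalence = record
  { refl  = λ {X} → ≈-refl X
  ; sym   = λ (X⊑Y , Y⊑X) → Y⊑X , X⊑Y
  ; trans = λ {X} {Y} {Z} (X⊑Y , Y⊑X) (Y⊑Z , Z⊑Y) → ⊑-trans X Y Z X⊑Y Y⊑Z , ⊑-trans Z Y X Z⊑Y Y⊑X
  }

≈-setoid : ℕ → Setoid 0ℓ 0ℓ
≈-setoid n = record { isEquivalence = ≈-isEquivalence {n} }

≈-trans : {X Y Z : 𝒜 n} → X ≈ Y → Y ≈ Z → X ≈ Z
≈-trans {X = X} {Y} {Z} = IsEquivalence.trans ≈-isEquivalence {X} {Y} {Z}

-- The operations of 𝒜[n] up to ≈

⊙-mono : (A A' B B' : 𝒜 n) → A ⊑ A' → B ⊑ B' → (A ⊙ B) ⊑ (A' ⊙ B')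
⊙-mono A A' B B' A⊑A' B⊑B' = ⊑-via-gens (A ⊙ B) (A' ⊙ B') (gens-⊙ A B) (gens-⊙ A' B')
  (⊞-mono-⊑ᴸ (⊑⇒⊑ᴸ A A' A⊑A') (⊑⇒⊑ᴸ B B' B⊑B'))

⊕-mono : (A A' B B' : 𝒜 n) → A ⊑ A' → B ⊑ B' → (A ⊕ B) ⊑ (A' ⊕ B')
⊕-mono A A' B B' A⊑A' B⊑B' = ⊑-via-gens (A ⊕ B) (A' ⊕ B') (gens-⊕ A B) (gens-⊕ A' B')
  (++-mono-⊑ᴸ (⊑⇒⊑ᴸ A A' A⊑A') (⊑⇒⊑ᴸ B B' B⊑B'))

⊙-cong : {A A' B B' : 𝒜 n} → A ≈ A' → B ≈ B' → (A ⊙ B) ≈ (A' ⊙ B')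
⊙-cong {A = A} {A'} {B} {B'} (A⊑A' , A'⊑A) (B⊑B' , B'⊑B) =
  ⊙-mono A A' B B' A⊑A' B⊑B' , ⊙-mono A' A B' B A'⊑A B'⊑B

⊕-cong : {A A' B B' : 𝒜 n} → A ≈ A' → B ≈ B' → (A ⊕ B) ≈ (A' ⊕ B')
⊕-cong {A = A} {A'} {B} {B'} (A⊑A' , A'⊑A) (B⊑B' , B'⊑B) =
  ⊕-mono A A' B B' A⊑A' B⊑B' , ⊕-mono A' A B' B A'⊑A B'⊑B

⊙-comm : (A B : 𝒜 n) → (A ⊙ B) ≈ (B ⊙ A)
⊙-comm A B = comm A B , comm B A
  where
  comm : (A B : 𝒜 _) → (A ⊙ B) ⊑ (B ⊙ A)
  comm A B = ⊑-via-gens (A ⊙ B) (B ⊙ A) (gens-⊙ A B) (gens-⊙ B A) (⊆≗⇒⊑ᴸ (⊞-comm (gens A) (gens B)))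

⊙-assoc : (A B C : 𝒜 n) → ((A ⊙ B) ⊙ C) ≈ (A ⊙ (B ⊙ C))
⊙-assoc A B C =
  ⊑-via-gens ((A ⊙ B) ⊙ C) (A ⊙ (B ⊙ C)) gens-l gens-r (⊆≗⇒⊑ᴸ (⊞-assocˡ (gens A) (gens B) (gens C))) ,
  ⊑-via-gens (A ⊙ (B ⊙ C)) ((A ⊙ B) ⊙ C) gens-r gens-l (⊆≗⇒⊑ᴸ (⊞-assocʳ (gens A) (gens B) (gens C)))
  where
  gens-l : gens ((A ⊙ B) ⊙ C) ≡ (gens A ⊞ gens B) ⊞ gens C
  gens-l = trans (gens-⊙ (A ⊙ B) C) (cong (_⊞ gens C) (gens-⊙ A B))
  gens-r : gens (A ⊙ (B ⊙ C)) ≡ gens A ⊞ (gens B ⊞ gens C)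
  gens-r = trans (gens-⊙ A (B ⊙ C)) (cong (gens A ⊞_) (gens-⊙ B C))

⊙-distribˡ-⊕ : (V A B : 𝒜 n) → (V ⊙ (A ⊕ B)) ≈ ((V ⊙ A) ⊕ (V ⊙ B))
⊙-distribˡ-⊕ V A B =
  ⊑-via-gens (V ⊙ (A ⊕ B)) ((V ⊙ A) ⊕ (V ⊙ B)) gens-l gens-r (⊆⇒⊑ᴸ (⊞-distribˡ-++ (gens V) (gens A) (gens B))) ,
  ⊑-via-gens ((V ⊙ A) ⊕ (V ⊙ B)) (V ⊙ (A ⊕ B)) gens-r gens-l (⊆⇒⊑ᴸ (⊞-factorˡ-++ (gens V) (gens A) (gens B)))
  where
  gens-l : gens (V ⊙ (A ⊕ B)) ≡ gens V ⊞ (gens A ++ gens B)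
  gens-l = trans (gens-⊙ V (A ⊕ B)) (cong (gens V ⊞_) (gens-⊕ A B))
  gens-r : gens ((V ⊙ A) ⊕ (V ⊙ B)) ≡ gens V ⊞ gens A ++ gens V ⊞ gens B
  gens-r = trans (gens-⊕ (V ⊙ A) (V ⊙ B)) (cong₂ _++_ (gens-⊙ V A) (gens-⊙ V B))

⊙-cancelˡ : (v : Poly n) (A B : 𝒜 n) → (just v ⊙ A) ≈ (just v ⊙ B) → A ≈ B
⊙-cancelˡ v@(v₀ List⁺.∷ vs) A B (vA⊑vB , vB⊑vA) = cancel⊑ A B vA⊑vB , cancel⊑ B A vB⊑vA
  where
  cancel⊑ : (A B : 𝒜 _) → (just v ⊙ A) ⊑ (just v ⊙ B) → A ⊑ B
  cancel⊑ A B vA⊑vB = ⊑ᴸ⇒⊑ A B (⊞-cancelˡ-⊑ᴸ v₀ vs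
    (subst₂ _⊑ᴸ_ (gens-⊙ (just v) A) (gens-⊙ (just v) B) (⊑⇒⊑ᴸ (just v ⊙ A) (just v ⊙ B) vA⊑vB)))

⊙-isCommutativeSemigroup : IsCommutativeSemigroup (_≈_ {n}) _⊙_
⊙-isCommutativeSemigroup = record
  { isSemigroup = record
    { isMagma = record { isEquivalence = ≈-isEquivalence ; ∙-cong = ⊙-cong }
    ; assoc   = ⊙-assoc
    }
  ; comm = ⊙-comm
  }

⊙-commutativeSemigroup : ℕ → CommutativeSemigroup 0ℓ 0ℓ
⊙-commutativeSemigroup n = record { isCommutativeSemigroup = ⊙-isCommutativeSemigroup {n} }

⊙-zeroʳ : (X : 𝒜 n) → (X ⊙ 0𝒜) ≈ 0𝒜
⊙-zeroʳ {n} nothing  = ≈-refl {n} 0𝒜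
⊙-zeroʳ {n} (just _) = ≈-refl {n} 0𝒜

⊙-distribʳ-⊕ : (V A B : 𝒜 n) → ((A ⊕ B) ⊙ V) ≈ ((A ⊙ V) ⊕ (B ⊙ V))
⊙-distribʳ-⊕ {n} V A B = begin
  (A ⊕ B) ⊙ V          ≈⟨ ⊙-comm (A ⊕ B) V ⟩
  V ⊙ (A ⊕ B)          ≈⟨ ⊙-distribˡ-⊕ V A B ⟩
  (V ⊙ A) ⊕ (V ⊙ B)    ≈⟨ ⊕-cong (⊙-comm V A) (⊙-comm V B) ⟩
  (A ⊙ V) ⊕ (B ⊙ V)    ∎
  where open SetoidReasoning (≈-setoid n)

⨁-cong : ∀ r {f g : Fin r → 𝒜 n} → (∀ i → f i ≈ g i) → ⨁ r f ≈ ⨁ r g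
⨁-cong {n} ℕ.zero _ = ≈-refl {n} 0𝒜
⨁-cong (ℕ.suc r) f≈g = ⊕-cong (f≈g zero) (⨁-cong r (λ i → f≈g (suc i)))

⊙-distribˡ-⨁ : ∀ r (V : 𝒜 n) (f : Fin r → 𝒜 n) → (V ⊙ ⨁ r f) ≈ ⨁ r (λ i → V ⊙ f i)
⊙-distribˡ-⨁ ℕ.zero    V f = ⊙-zeroʳ V
⊙-distribˡ-⨁ {n} (ℕ.suc r) V f = begin
  V ⊙ (f zero ⊕ ⨁ r (λ i → f (suc i)))           ≈⟨ ⊙-distribˡ-⊕ V (f zero) (⨁ r (λ i → f (suc i))) ⟩
  (V ⊙ f zero) ⊕ (V ⊙ ⨁ r (λ i → f (suc i)))
    ≈⟨ ⊕-cong (≈-refl (V ⊙ f zero)) (⊙-distribˡ-⨁ r V (λ i → f (suc i))) ⟩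
  (V ⊙ f zero) ⊕ ⨁ r (λ i → V ⊙ f (suc i))       ∎
  where open SetoidReasoning (≈-setoid n)

joinAll-⊙ : ∀ {r} (L : List (Tuple n r)) (V : 𝒜 n) i →
            (joinAll L i ⊙ V) ≈ joinAll (List.map (λ Z j → Z j ⊙ V) L) i
joinAll-⊙ {n} []      V i = ≈-refl {n} 0𝒜
joinAll-⊙ {n} (Z ∷ L) V i = begin
  (Z i ⊕ joinAll L i) ⊙ V                              ≈⟨ ⊙-distribʳ-⊕ V (Z i) (joinAll L i) ⟩
  (Z i ⊙ V) ⊕ (joinAll L i ⊙ V)                        ≈⟨ ⊕-cong (≈-refl (Z i ⊙ V)) (joinAll-⊙ L V i) ⟩
  (Z i ⊙ V) ⊕ joinAll (List.map (λ Z j → Z j ⊙ V) L) i ∎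
  where open SetoidReasoning (≈-setoid n)

-- Solutions

module _ {n r : ℕ} (P : Tuple n r) where

  𝓜-resp-≈ᵗ : ∀ {X Y Z} → Y ≈ᵗ Z → 𝓜 P X Y → 𝓜 P X Z
  𝓜-resp-≈ᵗ {X} {Y} {Z} Y≈Z X≈ = begin
    X                           ≈⟨ X≈ ⟩
    ⨁ r (λ i → P i ⊙ Y i)       ≈⟨ ⨁-cong r (λ i → ⊙-cong (≈-refl (P i)) (Y≈Z i)) ⟩
    ⨁ r (λ i → P i ⊙ Z i)       ∎
    where open SetoidReasoning (≈-setoid n)

  𝓜-⊙ˡ : ∀ V {X Z} → 𝓜 P X Z → 𝓜 P (V ⊙ X) (λ i → V ⊙ Z i)
  𝓜-⊙ˡ V {X} {Z} X≈ = begin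
    V ⊙ X                         ≈⟨ ⊙-cong (≈-refl V) X≈ ⟩
    V ⊙ ⨁ r (λ i → P i ⊙ Z i)     ≈⟨ ⊙-distribˡ-⨁ r V (λ i → P i ⊙ Z i) ⟩
    ⨁ r (λ i → V ⊙ (P i ⊙ Z i))   ≈⟨ ⨁-cong r (λ i → x∙yz≈y∙xz V (P i) (Z i)) ⟩
    ⨁ r (λ i → P i ⊙ (V ⊙ Z i))   ∎
    where
    open SetoidReasoning (≈-setoid n)
    open CommutativeSemigroupProperties (⊙-commutativeSemigroup n) using (x∙yz≈y∙xz)

  𝓜-⊙ˡ⁻ : ∀ v {X Z} → 𝓜 P (just v ⊙ X) (λ i → just v ⊙ Z i) → 𝓜 P X Z
  𝓜-⊙ˡ⁻ v {X} {Z} vX≈ = ⊙-cancelˡ v X (⨁ r (λ i → P i ⊙ Z i)) (begin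
    just v ⊙ X                         ≈⟨ vX≈ ⟩
    ⨁ r (λ i → P i ⊙ (just v ⊙ Z i))   ≈⟨ 𝓜-⊙ˡ (just v) (≈-refl (⨁ r (λ i → P i ⊙ Z i))) ⟨
    just v ⊙ ⨁ r (λ i → P i ⊙ Z i)     ∎)
    where open SetoidReasoning (≈-setoid n)

module _ {n r : ℕ} {S T : Tuple n r → Set} (f : Tuple n r → Tuple n r)
         (f-cong : ∀ {Y Z} → Y ≈ᵗ Z → f Y ≈ᵗ f Z)
         (f-sound : ∀ {Z} → S Z → T (f Z))
         (f-onto : ∀ {Y} → T Y → ∃ λ Z → S Z × Y ≈ᵗ f Z)
         where

  Enumerates-map : ∀ {L} → Enumerates S L → Enumerates T (List.map f L)
  Enumerates-map (all-S , complete) =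
    AllP.map⁺ (All.map f-sound all-S) ,
    λ Y T-Y → let Z , S-Z , Y≈fZ = f-onto T-Y in
      AnyP.map⁺ (Any.map (λ Z≈Z' i → ≈-trans (Y≈fZ i) (f-cong Z≈Z' i)) (complete Z S-Z))

  IsCanonical-map : (∀ L → f (joinAll L) ≈ᵗ joinAll (List.map f L)) →
                    ∀ {C} → IsCanonical S C → IsCanonical T (f C)
  IsCanonical-map f-joinAll (L , enumerates , C≈) =
    List.map f L , Enumerates-map enumerates , λ i → ≈-trans (f-cong C≈ i) (f-joinAll L i)

module _ {n r : ℕ} (P : Tuple n r) (v : Poly n) (U : 𝒜 n) where

  𝓜⇒𝓜V : ∀ {Z} → 𝓜 P U Z → 𝓜V P (just v ⊙ U) (just v) (λ i → Z i ⊙ just v)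
  𝓜⇒𝓜V {Z} Z∈𝓜 =
    𝓜-resp-≈ᵗ P (λ i → ⊙-comm (just v) (Z i)) (𝓜-⊙ˡ P (just v) Z∈𝓜) , λ i → Z i , ⊙-comm (Z i) (just v)

  𝓜V⇒𝓜 : ∀ {Y} → 𝓜V P (just v ⊙ U) (just v) Y → ∃ λ Z → 𝓜 P U Z × Y ≈ᵗ (λ i → Z i ⊙ just v)
  𝓜V⇒𝓜 {Y} (Y∈𝓜 , summand) =
    Z , 𝓜-⊙ˡ⁻ P v (𝓜-resp-≈ᵗ P Y≈vZ Y∈𝓜) , λ i → ≈-trans (Y≈vZ i) (⊙-comm (just v) (Z i))
    where
    Z : Tuple n r
    Z i = proj₁ (summand i)
    Y≈vZ : Y ≈ᵗ (λ i → just v ⊙ Z i)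
    Y≈vZ i = proj₂ (summand i)

mainTheorem10 : ∀ {n r} (P : Tuple n r) (V U : 𝒜 n) →
    (∀ i → ∃ λ p → P i ≡ just p) →
    (∃ λ v → V ≡ just v) →
    (∃ λ u → U ≡ just u) →
    ∃ (𝓜 P U) →
    ∃ (𝓜V P (V ⊙ U) V)
    × (∀ CU → IsCanonical (𝓜 P U) CU →
         IsCanonical (𝓜V P (V ⊙ U) V) (λ i → CU i ⊙ V))
mainTheorem10 P .(just v) U _ (v , refl) _ (Y , Y∈𝓜) =
  (shift Y , 𝓜⇒𝓜V P v U Y∈𝓜) ,
  λ _ → IsCanonical-map shift (λ Y≈Z i → ⊙-cong (Y≈Z i) (≈-refl (just v)))
          (𝓜⇒𝓜V P v U) (𝓜V⇒𝓜 P v U) (λ L → joinAll-⊙ L (just v))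
  where
  shift : Tuple _ _ → Tuple _ _
  shift Z i = Z i ⊙ just v
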